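{- Let $S$ be a Kleene relation algebra satisfying the Tarski rule, let $x \in S$ be a mapping and let $y, z \in S$ be points. Define $u = (y \sqcap (x^T\cdot z)^T) \sqcup (\overline{y} \sqcap x)$ and $w = (z \sqcap (x^T \cdot y)^T) \sqcup (\overline{z} \sqcap u)$. Then $w$ is a mapping.
   Context: A Kleene relation algebra is a structure $(S,\sqcup,\sqcap,\cdot,\overline{\phantom{x}},{}^T,{}^*,\bot,\top,1)$ such that $(S,\sqcup,\sqcap,\overline{\phantom{x}},\bot,\top)$ is a Boolean algebra with order $x \sqsubseteq y \iff x \sqcup y = y$; $(S,\sqcup,\cdot,\bot,1)$ is an idempotent semiring ($\cdot$ associative with two-sided unit $1$, distributing over $\sqcup$, $\bot$ a two-sided zero of $\cdot$); transposition satisfies $(x\sqcup y)^T = x^T \sqcup y^T$, $(x^T)^T = x$, $(x\cdot y)^T = y^T\cdot x^T$ and $(x\cdot y)\sqcap z \sqsubseteq x\cdot(y\sqcap(x^T\cdot z))$; and the star satisfies $1\sqcup y\cdot y^* = y^* = 1 \sqcup y^*\cdot y$, $z\sqcup y\cdot x\sqsubseteq x \Rightarrow y^*\cdot z\sqsubseteq x$, $z \sqcup x\cdot y \sqsubseteq x \Rightarrow z\cdot y^*\sqsubseteq x$. The Tarski rule states $\top\cdot x\cdot\top = \top$ for every $x \neq \bot$. An element $x$ is univalent if $x^T\cdot x\sqsubseteq 1$, total if $1 \sqsubseteq x\cdot x^T$, a mapping if univalent and total, injective if $x\cdot x^T\sqsubseteq 1$, surjective if $1\sqsubseteq x^T\cdot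 x$, a vector if $x\cdot\top = x$, and a point if it is an injective surjective vector. (In array terms, $w$ is obtained from array $x$ by swapping the values at indices $y$ and $z$: array read is $x^T\cdot y$ and array update of $x$ at $y$ to $z$ is $(y\sqcap z^T)\sqcup(\overline y \sqcap x)$.) -}

module Defs where

open import Level using (Level; suc)
open import Relation.Binary.PropositionalEquality using (_≡_)
open import Relation.Nullary using (¬_)

record KleeneRelationAlgebra (a : Level) : Set (suc a) where
  infixr 6 _⊔_
  infixr 7 _⊓_
  infixl 8 _·_
  infix 4 _⊑_
  field
    S    : Set a
    _⊔_  : S → S → S
    _⊓_  : S → S → S
    _·_  : S → S → S
    ‾    : S → S
    _ᵀ   : S → S
    _*   : S → S
    ⊥    : S
    ⊤    : S
    𝟏    : S

  _⊑_ : S → S → Set a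
  x ⊑ y = x ⊔ y ≡ y

  field
    ⊔-assoc    : ∀ x y z → (x ⊔ y) ⊔ z ≡ x ⊔ (y ⊔ z)
    ⊔-comm     : ∀ x y → x ⊔ y ≡ y ⊔ x
    ⊓-assoc    : ∀ x y z → (x ⊓ y) ⊓ z ≡ x ⊓ (y ⊓ z)
    ⊓-comm     : ∀ x y → x ⊓ y ≡ y ⊓ x
    ⊔-absorb-⊓ : ∀ x y → x ⊔ (x ⊓ y) ≡ x
    ⊓-absorb-⊔ : ∀ x y → x ⊓ (x ⊔ y) ≡ x
    ⊓-distrib-⊔ : ∀ x y z → x ⊓ (y ⊔ z) ≡ (x ⊓ y) ⊔ (x ⊓ z)
    ⊔-identity : ∀ x → x ⊔ ⊥ ≡ x
    ⊓-identity : ∀ x → x ⊓ ⊤ ≡ x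
    compl-⊔    : ∀ x → x ⊔ ‾ x ≡ ⊤
    compl-⊓    : ∀ x → x ⊓ ‾ x ≡ ⊥
    ⊔-idem     : ∀ x → x ⊔ x ≡ x
    ·-assoc    : ∀ x y z → (x · y) · z ≡ x · (y · z)
    ·-identityˡ : ∀ x → 𝟏 · x ≡ x
    ·-identityʳ : ∀ x → x · 𝟏 ≡ x
    ·-distribˡ : ∀ x y z → x · (y ⊔ z) ≡ (x · y) ⊔ (x · z)
    ·-distribʳ : ∀ x y z → (x ⊔ y) · z ≡ (x · z) ⊔ (y · z)
    ·-zeroˡ    : ∀ x → ⊥ · x ≡ ⊥
    ·-zeroʳ    : ∀ x → x · ⊥ ≡ ⊥
    ᵀ-⊔        : ∀ x y → (x ⊔ y) ᵀ ≡ (x ᵀ) ⊔ (y ᵀ)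
    ᵀ-involutive : ∀ x → (x ᵀ) ᵀ ≡ x
    ᵀ-·        : ∀ x y → (x · y) ᵀ ≡ (y ᵀ) · (x ᵀ)
    dedekind   : ∀ x y z → (x · y) ⊓ z ⊑ x · (y ⊓ ((x ᵀ) · z))
    star-unfoldˡ : ∀ y → 𝟏 ⊔ (y · (y *)) ≡ y *
    star-unfoldʳ : ∀ y → 𝟏 ⊔ ((y *) · y) ≡ y *
    star-inductˡ : ∀ x y z → z ⊔ (y · x) ⊑ x → (y *) · z ⊑ x
    star-inductʳ : ∀ x y z → z ⊔ (x · y) ⊑ x → z · (y *) ⊑ x

  Tarski : Set a
  Tarski = ∀ x → ¬ (x ≡ ⊥) → ⊤ · x · ⊤ ≡ ⊤

  univalent : S → Set a
  univalent x = (x ᵀ) · x ⊑ 𝟏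

  total : S → Set a
  total x = 𝟏 ⊑ x · (x ᵀ)

  record mapping (x : S) : Set a where
    field
      isUnivalent : univalent x
      isTotal     : total x

  injective : S → Set a
  injective x = x · (x ᵀ) ⊑ 𝟏

  surjective : S → Set a
  surjective x = 𝟏 ⊑ (x ᵀ) · x

  vector : S → Set a
  vector x = x · ⊤ ≡ x

  record point (x : S) : Set a where
    field
      isInjective  : injective x
      isSurjective : surjective x
      isVector     : vector x

-- Both u and w are array updates  (p ⊓ vᵀ) ⊔ (‾ p ⊓ m)  of a mapping m at a point p with a
-- point value v, the value being a read  xᵀ · q  of the mapping x at a point q, which is again
-- a point.  An update of a mapping at a vector by a point is a mapping: its two parts are
-- univalent with disjoint domains, since  pᵀ · ‾ p = ⊥  for a vector p, and on the domain p
-- totality comes from the surjectivity of v, on ‾ p from the totality of m.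
module Submission where

open import Level using (Level)
open import Relation.Binary.PropositionalEquality using (_≡_; refl; sym; trans; cong; isEquivalence)
open import Relation.Binary.Bundles using (Poset)
open import Defs

module KleeneRelationAlgebraProperties {ℓ : Level} (K : KleeneRelationAlgebra ℓ) where
  open KleeneRelationAlgebra K

  ⊑-reflexive : ∀ {x y} → x ≡ y → x ⊑ y
  ⊑-reflexive {x} refl = ⊔-idem x

  ⊑-trans : ∀ {x y z} → x ⊑ y → y ⊑ z → x ⊑ z
  ⊑-trans {x} {y} {z} x⊑y y⊑z =
    trans (cong (x ⊔_) (sym y⊑z)) (trans (sym (⊔-assoc x y z)) (trans (cong (_⊔ z) x⊑y) y⊑z))

  ⊑-antisym : ∀ {x y} → x ⊑ y → y ⊑ x → x ≡ y
  ⊑-antisym {x} {y} x⊑y y⊑x = trans (sym y⊑x) (trans (⊔-comm y x) x⊑y)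

  ⊑-poset : Poset ℓ ℓ ℓ
  ⊑-poset = record
    { Carrier = S
    ; _≈_ = _≡_
    ; _≤_ = _⊑_
    ; isPartialOrder = record
      { isPreorder = record
        { isEquivalence = isEquivalence
        ; reflexive = ⊑-reflexive
        ; trans = ⊑-trans
        }
      ; antisym = ⊑-antisym
      }
    }

  open import Relation.Binary.Reasoning.PartialOrder ⊑-poset

  x⊑x⊔y : ∀ {x y} → x ⊑ x ⊔ y
  x⊑x⊔y {x} {y} = trans (sym (⊔-assoc x x y)) (cong (_⊔ y) (⊔-idem x))

  y⊑x⊔y : ∀ {x y} → y ⊑ x ⊔ y
  y⊑x⊔y {x} {y} = trans (cong (y ⊔_) (⊔-comm x y)) (trans (x⊑x⊔y {y} {x}) (⊔-comm y x))

  ⊔-least : ∀ {x y z} → x ⊑ z → y ⊑ z → x ⊔ y ⊑ z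
  ⊔-least {x} {y} {z} x⊑z y⊑z = trans (⊔-assoc x y z) (trans (cong (x ⊔_) y⊑z) x⊑z)

  ⊑⇒⊓≡ : ∀ {x y} → x ⊑ y → x ⊓ y ≡ x
  ⊑⇒⊓≡ {x} {y} x⊑y = trans (cong (x ⊓_) (sym x⊑y)) (⊓-absorb-⊔ x y)

  ⊓≡⇒⊑ : ∀ {x y} → x ⊓ y ≡ x → x ⊑ y
  ⊓≡⇒⊑ {x} {y} eq = trans (cong (_⊔ y) (sym eq))
    (trans (⊔-comm (x ⊓ y) y) (trans (cong (y ⊔_) (⊓-comm x y)) (⊔-absorb-⊓ y x)))

  ⊓-idem : ∀ x → x ⊓ x ≡ x
  ⊓-idem x = trans (cong (x ⊓_) (sym (⊔-absorb-⊓ x x))) (⊓-absorb-⊔ x (x ⊓ x))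

  x⊓y⊑x : ∀ {x y} → x ⊓ y ⊑ x
  x⊓y⊑x {x} {y} = ⊓≡⇒⊑ (trans (⊓-comm (x ⊓ y) x)
    (trans (sym (⊓-assoc x x y)) (cong (_⊓ y) (⊓-idem x))))

  x⊓y⊑y : ∀ {x y} → x ⊓ y ⊑ y
  x⊓y⊑y {x} {y} = trans (cong (_⊔ y) (⊓-comm x y)) (x⊓y⊑x {y} {x})

  ⊓-greatest : ∀ {x y z} → z ⊑ x → z ⊑ y → z ⊑ x ⊓ y
  ⊓-greatest {x} {y} {z} z⊑x z⊑y = ⊓≡⇒⊑ (trans (sym (⊓-assoc z x y))
    (trans (cong (_⊓ y) (⊑⇒⊓≡ z⊑x)) (⊑⇒⊓≡ z⊑y)))

  ⊥-least : ∀ {x} → ⊥ ⊑ x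
  ⊥-least {x} = trans (⊔-comm ⊥ x) (⊔-identity x)

  ⊤-greatest : ∀ {x} → x ⊑ ⊤
  ⊤-greatest {x} = ⊓≡⇒⊑ (⊓-identity x)

  ⊓-split : ∀ {a y c} → a ⊓ y ⊑ c → a ⊓ ‾ y ⊑ c → a ⊑ c
  ⊓-split {a} {y} {c} a⊓y⊑c a⊓‾y⊑c = begin
    a                    ≡⟨ sym (⊓-identity a) ⟩
    a ⊓ ⊤                ≡⟨ cong (a ⊓_) (sym (compl-⊔ y)) ⟩
    a ⊓ (y ⊔ ‾ y)        ≡⟨ ⊓-distrib-⊔ a y (‾ y) ⟩
    (a ⊓ y) ⊔ (a ⊓ ‾ y)  ≤⟨ ⊔-least a⊓y⊑c a⊓‾y⊑c ⟩
    c                    ∎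

  ⊓⊑⊥⇒⊑‾ : ∀ {a y} → a ⊓ y ⊑ ⊥ → a ⊑ ‾ y
  ⊓⊑⊥⇒⊑‾ a⊓y⊑⊥ = ⊓-split (⊑-trans a⊓y⊑⊥ ⊥-least) x⊓y⊑y

  ·-monoˡ : ∀ {x y z} → y ⊑ z → y · x ⊑ z · x
  ·-monoˡ {x} {y} {z} y⊑z = trans (sym (·-distribʳ y z x)) (cong (_· x) y⊑z)

  ·-monoʳ : ∀ {x y z} → y ⊑ z → x · y ⊑ x · z
  ·-monoʳ {x} {y} {z} y⊑z = trans (sym (·-distribˡ x y z)) (cong (x ·_) y⊑z)

  ·-mono : ∀ {a b c d} → a ⊑ b → c ⊑ d → a · c ⊑ b · d
  ·-mono a⊑b c⊑d = ⊑-trans (·-monoˡ a⊑b) (·-monoʳ c⊑d)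

  ·-distrib-⊔ : ∀ p q r s → (p ⊔ q) · (r ⊔ s) ≡ (p · r ⊔ p · s) ⊔ (q · r ⊔ q · s)
  ·-distrib-⊔ p q r s = begin-equality
    (p ⊔ q) · (r ⊔ s)                  ≡⟨ ·-distribʳ p q (r ⊔ s) ⟩
    p · (r ⊔ s) ⊔ q · (r ⊔ s)          ≡⟨ cong (_⊔ q · (r ⊔ s)) (·-distribˡ p r s) ⟩
    (p · r ⊔ p · s) ⊔ q · (r ⊔ s)      ≡⟨ cong ((p · r ⊔ p · s) ⊔_) (·-distribˡ q r s) ⟩
    (p · r ⊔ p · s) ⊔ (q · r ⊔ q · s)  ∎

  ·-assoc-middle : ∀ a b c d → (a · b) · (c · d) ≡ a · ((b · c) · d)
  ·-assoc-middle a b c d = trans (·-assoc a b (c · d)) (cong (a ·_) (sym (·-assoc b c d)))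

  ᵀ-mono : ∀ {x y} → x ⊑ y → x ᵀ ⊑ y ᵀ
  ᵀ-mono {x} {y} x⊑y = trans (sym (ᵀ-⊔ x y)) (cong _ᵀ x⊑y)

  ᵀ-⊥ : ⊥ ᵀ ≡ ⊥
  ᵀ-⊥ = ⊑-antisym (⊑-trans (ᵀ-mono (⊥-least {⊥ ᵀ})) (⊑-reflexive (ᵀ-involutive ⊥))) ⊥-least

  ᵀ-⊤ : ⊤ ᵀ ≡ ⊤
  ᵀ-⊤ = ⊑-antisym ⊤-greatest
    (⊑-trans (⊑-reflexive (sym (ᵀ-involutive ⊤))) (ᵀ-mono (⊤-greatest {⊤ ᵀ})))

  ᵀ-ᵀ· : ∀ x y → (x ᵀ · y) ᵀ ≡ y ᵀ · x
  ᵀ-ᵀ· x y = trans (ᵀ-· (x ᵀ) y) (cong (y ᵀ ·_) (ᵀ-involutive x))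

  ᵀ·⊑⊥-sym : ∀ {a b} → a ᵀ · b ⊑ ⊥ → b ᵀ · a ⊑ ⊥
  ᵀ·⊑⊥-sym {a} {b} aᵀb⊑⊥ = begin
    b ᵀ · a        ≡⟨ sym (ᵀ-ᵀ· a b) ⟩
    (a ᵀ · b) ᵀ    ≤⟨ ᵀ-mono aᵀb⊑⊥ ⟩
    ⊥ ᵀ            ≡⟨ ᵀ-⊥ ⟩
    ⊥              ∎

  𝟏⊓x⊑x·xᵀ : ∀ x → 𝟏 ⊓ x ⊑ x · x ᵀ
  𝟏⊓x⊑x·xᵀ x = begin
    𝟏 ⊓ x                ≡⟨ ⊓-comm 𝟏 x ⟩
    x ⊓ 𝟏                ≡⟨ cong (_⊓ 𝟏) (sym (·-identityʳ x)) ⟩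
    x · 𝟏 ⊓ 𝟏            ≤⟨ dedekind x 𝟏 𝟏 ⟩
    x · (𝟏 ⊓ x ᵀ · 𝟏)    ≤⟨ ·-monoʳ x⊓y⊑y ⟩
    x · (x ᵀ · 𝟏)        ≡⟨ cong (x ·_) (·-identityʳ (x ᵀ)) ⟩
    x · x ᵀ              ∎

  vector-ᵀ·‾ : ∀ {y} → vector y → y ᵀ · ‾ y ⊑ ⊥
  vector-ᵀ·‾ {y} y-vector = begin
    y ᵀ · ‾ y                     ≡⟨ sym (⊓-identity _) ⟩
    y ᵀ · ‾ y ⊓ ⊤                 ≤⟨ dedekind (y ᵀ) (‾ y) ⊤ ⟩
    y ᵀ · (‾ y ⊓ (y ᵀ) ᵀ · ⊤)     ≡⟨ cong (λ t → y ᵀ · (‾ y ⊓ t · ⊤)) (ᵀ-involutive y) ⟩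
    y ᵀ · (‾ y ⊓ y · ⊤)           ≡⟨ cong (λ t → y ᵀ · (‾ y ⊓ t)) y-vector ⟩
    y ᵀ · (‾ y ⊓ y)               ≡⟨ cong (y ᵀ ·_) (trans (⊓-comm (‾ y) y) (compl-⊓ y)) ⟩
    y ᵀ · ⊥                       ≡⟨ ·-zeroʳ (y ᵀ) ⟩
    ⊥                             ∎

  vector-‾ : ∀ {y} → vector y → vector (‾ y)
  vector-‾ {y} y-vector = ⊑-antisym ‾y⊤⊑‾y ‾y⊑‾y⊤
    where
    ‾y⊤⊑‾y : ‾ y · ⊤ ⊑ ‾ y
    ‾y⊤⊑‾y = ⊓⊑⊥⇒⊑‾ (begin
      ‾ y · ⊤ ⊓ y                  ≤⟨ dedekind (‾ y) ⊤ y ⟩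
      ‾ y · (⊤ ⊓ (‾ y) ᵀ · y)      ≤⟨ ·-monoʳ (⊑-trans x⊓y⊑y (ᵀ·⊑⊥-sym (vector-ᵀ·‾ y-vector))) ⟩
      ‾ y · ⊥                      ≡⟨ ·-zeroʳ (‾ y) ⟩
      ⊥                            ∎)
    ‾y⊑‾y⊤ : ‾ y ⊑ ‾ y · ⊤
    ‾y⊑‾y⊤ = ⊑-trans (⊑-reflexive (sym (·-identityʳ (‾ y)))) (·-monoʳ ⊤-greatest)

  ⊤·ᵀ-vector : ∀ {v} → vector v → ⊤ · v ᵀ ≡ v ᵀ
  ⊤·ᵀ-vector {v} v-vector = begin-equality
    ⊤ · v ᵀ      ≡⟨ cong (_· v ᵀ) (sym ᵀ-⊤) ⟩
    ⊤ ᵀ · v ᵀ    ≡⟨ sym (ᵀ-· v ⊤) ⟩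
    (v · ⊤) ᵀ    ≡⟨ cong _ᵀ v-vector ⟩
    v ᵀ          ∎

  univalent-antitone : ∀ {a b} → a ⊑ b → univalent b → univalent a
  univalent-antitone a⊑b = ⊑-trans (·-mono (ᵀ-mono a⊑b) a⊑b)

  univalent-⊔ : ∀ {a b} → univalent a → univalent b → a ᵀ · b ⊑ ⊥ → univalent (a ⊔ b)
  univalent-⊔ {a} {b} a-univalent b-univalent aᵀb⊑⊥ = begin
    (a ⊔ b) ᵀ · (a ⊔ b)                          ≡⟨ cong (_· (a ⊔ b)) (ᵀ-⊔ a b) ⟩
    (a ᵀ ⊔ b ᵀ) · (a ⊔ b)                        ≡⟨ ·-distrib-⊔ (a ᵀ) (b ᵀ) a b ⟩
    (a ᵀ · a ⊔ a ᵀ · b) ⊔ (b ᵀ · a ⊔ b ᵀ · b)   ≤⟨ ⊔-least (⊔-least a-univalent aᵀb⊑𝟏)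
                                                              (⊔-least bᵀa⊑𝟏 b-univalent) ⟩
    𝟏                                            ∎
    where
    aᵀb⊑𝟏 : a ᵀ · b ⊑ 𝟏
    aᵀb⊑𝟏 = ⊑-trans aᵀb⊑⊥ ⊥-least
    bᵀa⊑𝟏 : b ᵀ · a ⊑ 𝟏
    bᵀa⊑𝟏 = ⊑-trans (ᵀ·⊑⊥-sym aᵀb⊑⊥) ⊥-least

  ·ᵀ-mono : ∀ {a b} → a ⊑ b → a · a ᵀ ⊑ b · b ᵀ
  ·ᵀ-mono a⊑b = ·-mono a⊑b (ᵀ-mono a⊑b)

  𝟏⊓⊑·total : ∀ {t} q → total t → 𝟏 ⊓ q ⊑ (q · t) · (q · t) ᵀ
  𝟏⊓⊑·total {t} q t-total = begin
    𝟏 ⊓ q                      ≤⟨ 𝟏⊓x⊑x·xᵀ q ⟩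
    q · q ᵀ                    ≡⟨ cong (q ·_) (sym (·-identityˡ (q ᵀ))) ⟩
    q · (𝟏 · q ᵀ)              ≤⟨ ·-monoʳ (·-monoˡ t-total) ⟩
    q · ((t · t ᵀ) · q ᵀ)      ≡⟨ sym (·-assoc-middle q t (t ᵀ) (q ᵀ)) ⟩
    (q · t) · (t ᵀ · q ᵀ)      ≡⟨ cong ((q · t) ·_) (sym (ᵀ-· q t)) ⟩
    (q · t) · (q · t) ᵀ        ∎

  point-mappingᵀ· : ∀ {x z} → mapping x → point z → point (x ᵀ · z)
  point-mappingᵀ· {x} {z} x-mapping z-point = record
    { isInjective = begin
        (x ᵀ · z) · (x ᵀ · z) ᵀ      ≡⟨ cong ((x ᵀ · z) ·_) (ᵀ-ᵀ· x z) ⟩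
        (x ᵀ · z) · (z ᵀ · x)        ≡⟨ ·-assoc-middle (x ᵀ) z (z ᵀ) x ⟩
        x ᵀ · ((z · z ᵀ) · x)        ≤⟨ ·-monoʳ (·-monoˡ (point.isInjective z-point)) ⟩
        x ᵀ · (𝟏 · x)                ≡⟨ cong (x ᵀ ·_) (·-identityˡ x) ⟩
        x ᵀ · x                      ≤⟨ mapping.isUnivalent x-mapping ⟩
        𝟏                            ∎
    ; isSurjective = begin
        𝟏                            ≤⟨ point.isSurjective z-point ⟩
        z ᵀ · z                      ≡⟨ cong (z ᵀ ·_) (sym (·-identityˡ z)) ⟩
        z ᵀ · (𝟏 · z)                ≤⟨ ·-monoʳ (·-monoˡ (mapping.isTotal x-mapping)) ⟩
        z ᵀ · ((x · x ᵀ) · z)        ≡⟨ sym (·-assoc-middle (z ᵀ) x (x ᵀ) z) ⟩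
        (z ᵀ · x) · (x ᵀ · z)        ≡⟨ cong (_· (x ᵀ · z)) (sym (ᵀ-ᵀ· x z)) ⟩
        (x ᵀ · z) ᵀ · (x ᵀ · z)      ∎
    ; isVector = trans (·-assoc (x ᵀ) z ⊤) (cong (x ᵀ ·_) (point.isVector z-point))
    }

  mapping-update : ∀ {x y v} → mapping x → vector y → point v →
                   mapping ((y ⊓ v ᵀ) ⊔ (‾ y ⊓ x))
  mapping-update {x} {y} {v} x-mapping y-vector v-point = record
    { isUnivalent = univalent-⊔
        (univalent-antitone x⊓y⊑y vᵀ-univalent)
        (univalent-antitone x⊓y⊑y (mapping.isUnivalent x-mapping))
        (⊑-trans (·-mono (ᵀ-mono x⊓y⊑x) x⊓y⊑x) (vector-ᵀ·‾ y-vector))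
    ; isTotal = ⊓-split total-on-y total-on-‾y
    }
    where
    m = (y ⊓ v ᵀ) ⊔ (‾ y ⊓ x)

    vᵀ-univalent : univalent (v ᵀ)
    vᵀ-univalent = ⊑-trans (⊑-reflexive (cong (_· v ᵀ) (ᵀ-involutive v))) (point.isInjective v-point)

    vᵀ-total : total (v ᵀ)
    vᵀ-total = ⊑-trans (point.isSurjective v-point) (⊑-reflexive (cong (v ᵀ ·_) (sym (ᵀ-involutive v))))

    yvᵀ⊑y⊓vᵀ : y · v ᵀ ⊑ y ⊓ v ᵀ
    yvᵀ⊑y⊓vᵀ = ⊓-greatest
      (⊑-trans (·-monoʳ ⊤-greatest) (⊑-reflexive y-vector))
      (⊑-trans (·-monoˡ ⊤-greatest) (⊑-reflexive (⊤·ᵀ-vector (point.isVector v-point))))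

    [𝟏⊓‾y]x⊑‾y⊓x : (𝟏 ⊓ ‾ y) · x ⊑ ‾ y ⊓ x
    [𝟏⊓‾y]x⊑‾y⊓x = ⊓-greatest
      (⊑-trans (·-mono x⊓y⊑y ⊤-greatest) (⊑-reflexive (vector-‾ y-vector)))
      (⊑-trans (·-monoˡ x⊓y⊑x) (⊑-reflexive (·-identityˡ x)))

    total-on-y : 𝟏 ⊓ y ⊑ m · m ᵀ
    total-on-y = begin
      𝟏 ⊓ y                          ≤⟨ 𝟏⊓⊑·total y vᵀ-total ⟩
      (y · v ᵀ) · (y · v ᵀ) ᵀ        ≤⟨ ·ᵀ-mono (⊑-trans yvᵀ⊑y⊓vᵀ x⊑x⊔y) ⟩
      m · m ᵀ                        ∎

    total-on-‾y : 𝟏 ⊓ ‾ y ⊑ m · m ᵀ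
    total-on-‾y = begin
      𝟏 ⊓ ‾ y                                      ≤⟨ ⊓-greatest x⊓y⊑x (⊑-reflexive refl) ⟩
      𝟏 ⊓ (𝟏 ⊓ ‾ y)                                ≤⟨ 𝟏⊓⊑·total (𝟏 ⊓ ‾ y) (mapping.isTotal x-mapping) ⟩
      ((𝟏 ⊓ ‾ y) · x) · ((𝟏 ⊓ ‾ y) · x) ᵀ          ≤⟨ ·ᵀ-mono (⊑-trans [𝟏⊓‾y]x⊑‾y⊓x y⊑x⊔y) ⟩
      m · m ᵀ                                      ∎

theorem2p10 : {a : Level} (K : KleeneRelationAlgebra a) →
    let open KleeneRelationAlgebra K in
    Tarski → (x y z : S) → mapping x → point y → point z →
    let u = (y ⊓ (((x ᵀ) · z) ᵀ)) ⊔ (‾ y ⊓ x) in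
    let w = (z ⊓ (((x ᵀ) · y) ᵀ)) ⊔ (‾ z ⊓ u) in
    mapping w
theorem2p10 K _ x y z x-mapping y-point z-point =
  mapping-update u-mapping (point.isVector z-point) (point-mappingᵀ· x-mapping y-point)
  where
  open KleeneRelationAlgebraProperties K
  open KleeneRelationAlgebra K
  u-mapping : mapping ((y ⊓ (x ᵀ · z) ᵀ) ⊔ (‾ y ⊓ x))
  u-mapping = mapping-update x-mapping (point.isVector y-point) (point-mappingᵀ· x-mapping z-point)
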